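{- Let $p\ge 2$ and $P=\{312,\;2431,\;(p+1)p\cdots 21\}$. Then $P$ is colored regular with set of colors $\{0,1\}$: there is a coloring of $S(P)$ by colors in $\{0,1\}$, with the empty permutation colored $0$, such that for every $\alpha\in S(P)$ site $1$ is active, and if $\alpha$ has $k$ active sites and color $c$, then for every $1\le i\le k$ the permutation $\alpha^{\downarrow i}$ has $\mu_P(i,k,c)$ active sites and color $\nu_P(i,k,c)$, where $$\mu_P(i,k,c)=\begin{cases} i+1 & \text{if } i=1 \text{ or } (i=k,\ c=0 \text{ and } k<p),\\ i & \text{otherwise,}\end{cases}\qquad \nu_P(i,k,c)=\begin{cases} 0 & \text{if } i=1 \text{ or } (i=k \text{ and } c=0),\\ 1 & \text{otherwise.}\end{cases}$$
   Context: A permutation contains a pattern $\sigma$ if some subsequence is order-isomorphic to $\sigma$; $S_n(P)$ is the set of permutations of $\{1,\dots,n\}$ avoiding all patterns of $P$ ($S_0(P)=\{\epsilon\}$), $S(P)=\bigcup_n S_n(P)$. A site of a length-$n$ permutation is one of its $n+1$ gaps, numbered from right to left (site $1$ is after the last entry; $\epsilon$ has one site). $\alpha^{\downarrow i}$ denotes the permutation obtained from $\alpha\in S_n$ by inserting $n+1$ into site $i$. For $\alpha\in S_n(P)$, site $i$ is active if $\alpha^{\downarrow i}\in S_{n+1}(P)$. $P$ is right-justified if moving the largest entry of any $\alpha\in S(P)$ one position right (when possible) stays in $S(P)$ (the set $P$ here is right-justified). A right-justified $P$ is colored regular if there is an integer coloring of $S(P)$ with $\epsilon$ colored $0$ such that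 every $\alpha\in S(P)$ has site $1$ active and, if $\alpha$ has $k$ active sites and color $c$, then for $1\le i\le k$ both the number of active sites and the color of $\alpha^{\downarrow i}$ depend only on $(i,k,c)$. -}

module Defs where

open import Data.Nat using (ℕ; zero; suc; _+_; _∸_; _<_; _≤_; _≡ᵇ_; _<ᵇ_)
open import Data.Bool using (Bool; true; false; _∧_; _∨_; if_then_else_)
open import Data.Fin using (Fin; toℕ) renaming (zero to fzero; suc to fsuc)
open import Data.Fin.Subset using (Subset; _∈_; ∣_∣)
open import Data.List using (List; []; _∷_; length; map; take; drop; _++_; upTo; downFrom)
open import Data.List.Relation.Binary.Sublist.Propositional using (_⊆_)
open import Data.List.Relation.Binary.Pointwise using (Pointwise)
open import Data.List.Relation.Binary.Permutation.Propositional using (_↭_)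
open import Data.List.Relation.Unary.All using (All)
open import Data.Product using (Σ; _×_)
open import Relation.Nullary using (¬_)
open import Relation.Binary.PropositionalEquality using (_≡_)
open import Function.Bundles using (_⇔_)

IsPerm : List ℕ → Set
IsPerm α = α ↭ map suc (upTo (length α))

data OrdIso : List ℕ → List ℕ → Set where
  []  : OrdIso [] []
  _∷_ : ∀ {x y xs ys} →
        Pointwise (λ a b → ((x < a) ⇔ (y < b)) × ((a < x) ⇔ (b < y))) xs ys →
        OrdIso xs ys → OrdIso (x ∷ xs) (y ∷ ys)

Contains : List ℕ → List ℕ → Set
Contains α σ = Σ (List ℕ) λ β → (β ⊆ α) × OrdIso β σ

Avoids : List (List ℕ) → List ℕ → Set
Avoids P α = All (λ σ → ¬ Contains α σ) P

InS : List (List ℕ) → List ℕ → Set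
InS P α = IsPerm α × Avoids P α

-- α^{↓i}: insert n+1 (n = length α) into site i; sites are numbered from
-- right to left, site 1 being after the last entry, so site i leaves i-1
-- entries to the right of the inserted one (1 ≤ i ≤ n+1).
ins : List ℕ → ℕ → List ℕ
ins α i = take (suc (length α) ∸ i) α ++ (suc (length α) ∷ drop (suc (length α) ∸ i) α)

Active : List (List ℕ) → List ℕ → ℕ → Set
Active P α i = (1 ≤ i) × (i ≤ suc (length α)) × InS P (ins α i)

-- α has exactly k active sites: the set of active sites (site j+1 for
-- j : Fin (n+1)) has cardinality k.
NumActive : List (List ℕ) → List ℕ → ℕ → Set
NumActive P α k =
  Σ (Subset (suc (length α))) λ s →
    (∣ s ∣ ≡ k) × (∀ (j : Fin (suc (length α))) → (j ∈ s) ⇔ Active P α (suc (toℕ j)))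

decr : ℕ → List ℕ
decr p = map suc (downFrom (suc p))

Pset : ℕ → List (List ℕ)
Pset p = (3 ∷ 1 ∷ 2 ∷ []) ∷ (2 ∷ 4 ∷ 3 ∷ 1 ∷ []) ∷ decr p ∷ []

isZero : Fin 2 → Bool
isZero fzero = true
isZero (fsuc _) = false

μ : ℕ → ℕ → ℕ → Fin 2 → ℕ
μ p i k c = if (i ≡ᵇ 1) ∨ ((i ≡ᵇ k) ∧ isZero c ∧ (k <ᵇ p)) then suc i else i

ν : ℕ → ℕ → Fin 2 → Fin 2
ν i k c = if (i ≡ᵇ 1) ∨ ((i ≡ᵇ k) ∧ isZero c) then fzero else fsuc fzero

-- Write γ ∈ S(P) as ws ++ zs with |zs| = m. Inserting the new maximum at site m+1 creates
-- no 312, no 2431 and no (p+1)p⋯21 exactly when zs is decreasing, |zs| < p, and no entry of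
-- ws lies strictly between two entries of zs that occur in decreasing order (Admissible).
-- This passes to shorter suffixes, so the active sites are 1,…,k. If n is the maximum of
-- γ = A n S, then sites 1,…,|S|+1 are active, site |S|+2 is active iff |S|+1 < p and every
-- entry of A is below every entry of S, and no later site is. Applied to α = A n S and to
-- α^{↓i} = X (n+1) Y this yields μ. Colouring γ by 0 iff A is below S or |S|+1 = p records
-- what the last active site of α needs: when i = k, site k+1 of α^{↓i} is active iff the
-- colour is 0 and k < p, and α^{↓i} inherits the colour of α.

module Submission where

open import Defs
open import Data.Bool using (true; false)
open import Data.Empty using (⊥)
open import Data.Fin using (Fin; toℕ; fromℕ<) renaming (zero to fzero; suc to fsuc)
open import Data.Fin.Properties using (toℕ<n; toℕ-fromℕ<)
open import Data.Fin.Subset using (Subset; inside; outside; ∣_∣) renaming (_∈_ to _∈ₛ_)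
open import Data.Fin.Subset.Properties using (drop-there; Empty-unique; ∣⊥∣≡0; ∣p∣≤n)
open import Data.List using (List; []; _∷_; [_]; length; map; take; drop; _++_; upTo; downFrom)
open import Data.List.Properties
  using (length-++; length-++-≤ʳ; length-++-sucʳ; length-map; length-downFrom; length-take; length-drop;
         ++-assoc; ++-identityʳ; ∷-injective; take++drop≡id; map-++; upTo-∷ʳ)
open import Data.List.Membership.Propositional using (_∈_)
open import Data.List.Membership.Propositional.Properties using (∈-++⁻; ∈-map⁺; ∈-upTo⁺)
open import Data.List.Relation.Unary.All as All using (All; []; _∷_)
open import Data.List.Relation.Unary.All.Properties using (all-upTo) renaming (map⁺ to All-map⁺)
open import Data.List.Relation.Unary.AllPairs using (AllPairs; []; _∷_)
open import Data.List.Relation.Unary.Any using (here; there)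
open import Data.List.Relation.Unary.Unique.Propositional using (Unique)
open import Data.List.Relation.Unary.Unique.Propositional.Properties using (upTo⁺) renaming (map⁺ to Unique-map⁺)
open import Data.List.Relation.Binary.Pointwise using (Pointwise; []; _∷_)
open import Data.List.Relation.Binary.Sublist.Propositional using (_⊆_; []; _∷_; _∷ʳ_; ⊆-refl; ⊆-trans; to∈; from∈)
open import Data.List.Relation.Binary.Sublist.Propositional.Properties
  using ([]⊆-universal; ++⁺ˡ; ++⁺ʳ; ++⁺; ∷ˡ⁻; ∷⁻; length-mono-≤; take-⊆; All-resp-⊆)
open import Data.List.Relation.Binary.Permutation.Propositional
  using (_↭_; prep; ↭-sym; ↭⇒↭ₛ; module PermutationReasoning)
open import Data.List.Relation.Binary.Permutation.Propositional.Properties using (All-resp-↭; ∈-resp-↭; shift; ++-comm)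
open import Data.Nat
  using (ℕ; zero; suc; _∸_; _≤_; _<_; _>_; z≤n; s≤s; s<s; z<s; s<s⁻¹; s≤s⁻¹; _≟_; _≤?_; _<?_; _≡ᵇ_; _<ᵇ_)
open import Data.Nat.Properties
open import Data.Product as Product using (Σ; ∃; ∃₂; _×_; _,_; proj₁; proj₂; uncurry)
open import Data.Sum as Sum using (_⊎_; inj₁; inj₂)
open import Data.Vec using ([]; _∷_; here; there)
open import Function.Base using (_∘_)
open import Function.Bundles using (_⇔_; mk⇔; Equivalence)
open import Function.Construct.Composition using (_⇔-∘_)
open import Function.Construct.Symmetry using (⇔-sym)
open import Relation.Binary.Definitions using (tri<; tri≈; tri>)
open import Relation.Binary.PropositionalEquality
  using (_≡_; _≢_; refl; sym; trans; cong; cong₂; subst; subst₂; setoid; module ≡-Reasoning)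
open import Data.List.Relation.Binary.Permutation.Setoid.Properties (setoid ℕ) using (Unique-resp-↭)
open import Relation.Nullary using (¬_; Dec; yes; no; contradiction)
open import Relation.Nullary.Decidable using (_⊎-dec_; _×-dec_)

private
  variable
    A : Set
    x y : A
    xs ys zs ws : List A

lookup-⊆ : {P : A → Set} → All P xs → [ x ] ⊆ xs → P x
lookup-⊆ ps x∈ = All.lookup ps (to∈ x∈)

head-⊆ : (x ∷ xs) ⊆ ys → [ x ] ⊆ ys
head-⊆ s = ⊆-trans (refl ∷ []⊆-universal _) s

[x]⊆-++⁻ : ∀ ws → [ x ] ⊆ ws ++ zs → [ x ] ⊆ ws ⊎ [ x ] ⊆ zs
[x]⊆-++⁻ ws x∈ = Sum.map from∈ from∈ (∈-++⁻ ws (to∈ x∈))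

AllPairs-resp-⊆ : {R : A → A → Set} → xs ⊆ ys → AllPairs R ys → AllPairs R xs
AllPairs-resp-⊆ [] _ = []
AllPairs-resp-⊆ (_ ∷ʳ s) (_ ∷ rs) = AllPairs-resp-⊆ s rs
AllPairs-resp-⊆ (refl ∷ s) (r ∷ rs) = All-resp-⊆ s r ∷ AllPairs-resp-⊆ s rs

AllPairs-pair : {R : A → A → Set} → AllPairs R xs → (x ∷ y ∷ []) ⊆ xs → R x y
AllPairs-pair rs s with AllPairs-resp-⊆ s rs
... | (r ∷ []) ∷ _ = r

⊆-++-∷⁻ : ∀ ws → xs ⊆ ws ++ y ∷ zs →
  xs ⊆ ws ++ zs ⊎ ∃₂ λ ws′ zs′ → xs ≡ ws′ ++ y ∷ zs′ × ws′ ⊆ ws × zs′ ⊆ zs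
⊆-++-∷⁻ [] (_ ∷ʳ s) = inj₁ s
⊆-++-∷⁻ [] (refl ∷ s) = inj₂ ([] , _ , refl , [] , s)
⊆-++-∷⁻ (w ∷ ws) (.w ∷ʳ s) with ⊆-++-∷⁻ ws s
... | inj₁ t = inj₁ (w ∷ʳ t)
... | inj₂ (ws′ , zs′ , eq , sw , sz) = inj₂ (ws′ , zs′ , eq , w ∷ʳ sw , sz)
⊆-++-∷⁻ (w ∷ ws) (refl ∷ s) with ⊆-++-∷⁻ ws s
... | inj₁ t = inj₁ (refl ∷ t)
... | inj₂ (ws′ , zs′ , refl , sw , sz) = inj₂ (w ∷ ws′ , zs′ , refl , refl ∷ sw , sz)

++-align : ∀ (xs : List A) {ys} ws {zs} → xs ++ ys ≡ ws ++ zs → length ys ≤ length zs →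
  ∃ λ ms → xs ≡ ws ++ ms × zs ≡ ms ++ ys
++-align xs [] eq _ = xs , refl , sym eq
++-align [] (w ∷ ws) {zs} refl le = contradiction le (<⇒≱ (s≤s (length-++-≤ʳ zs {ws})))
++-align (x ∷ xs) (w ∷ ws) eq le with ∷-injective eq
... | refl , eq′ with ++-align xs ws eq′ le
...   | ms , refl , eqz = ms , refl , eqz

long-suffix-crosses : ∀ ws zs xs ys → ws ++ zs ≡ xs ++ y ∷ ys → suc (suc (length ys)) ≤ length zs →
  ∃ λ x → [ x ] ⊆ xs × (x ∷ y ∷ []) ⊆ zs
long-suffix-crosses ws zs xs ys eq le with ++-align xs ws (sym eq) (<⇒≤ le)
... | [] , _ , refl = contradiction le 1+n≰n
... | m ∷ ms , refl , refl = m , ++⁺ˡ ws (refl ∷ []⊆-universal ms) , refl ∷ ++⁺ˡ ms (refl ∷ []⊆-universal ys)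

++-∷-short-suffix : ∀ (xs : List A) ys as bs {n} → xs ++ ys ≡ as ++ n ∷ bs → length ys ≤ length bs →
  [ n ] ⊆ xs × ys ⊆ bs
++-∷-short-suffix xs ys as bs eq ys≤bs with ++-align xs as eq (m≤n⇒m≤1+n ys≤bs)
... | [] , _ , refl = contradiction ys≤bs 1+n≰n
... | m ∷ ms , refl , refl = ++⁺ˡ as (refl ∷ []⊆-universal ms) , ++⁺ˡ ms ⊆-refl

++-∷-suffix-≡ : ∀ (xs : List A) ys as bs {n} → xs ++ ys ≡ as ++ n ∷ bs → length ys ≡ suc (length bs) →
  xs ≡ as × ys ≡ n ∷ bs
++-∷-suffix-≡ xs ys as bs eq ys≡ with ++-align xs as eq (≤-reflexive ys≡)
... | [] , xs≡ , refl = trans xs≡ (++-identityʳ as) , refl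
... | m ∷ ms , _ , eq′ = contradiction bs<bs (<-irrefl refl)
  where
  open ≤-Reasoning
  bs<bs : suc (length bs) < suc (length bs)
  bs<bs = begin-strict
    suc (length bs)         ≡⟨ sym ys≡ ⟩
    length ys               ≤⟨ length-++-≤ʳ ys {ms} ⟩
    length (ms ++ ys)       <⟨ n<1+n _ ⟩
    length (m ∷ ms ++ ys)   ≡⟨ cong length eq′ ⟨
    suc (length bs)         ∎

-- Orders on lists and the three patterns

Descending : List ℕ → Set
Descending = AllPairs _>_

_≪_ : List ℕ → List ℕ → Set
xs ≪ ys = All (λ x → All (x <_) ys) xs

_≪?_ : ∀ as bs → Dec (as ≪ bs)
as ≪? bs = All.all? (λ a → All.all? (a <?_) bs) as

≪-∷ : ∀ {n as bs} → All (_< n) as → as ≪ bs → as ≪ (n ∷ bs)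
≪-∷ as<n as≪bs = All.zipWith (λ (a<n , a≪bs) → a<n ∷ a≪bs) (as<n , as≪bs)

≪-after : ∀ {n xs ys} → [ n ] ⊆ xs → All (_< n) ys → 1 ≤ length ys → ¬ xs ≪ ys
≪-after {ys = y ∷ _} n∈xs (y<n ∷ _) _ xs≪ys = <-asym y<n (lookup-⊆ (lookup-⊆ xs≪ys n∈xs) (refl ∷ []⊆-universal _))

NoneBetween : List ℕ → List ℕ → Set
NoneBetween ws zs = ∀ {x y₁ y₂} → [ x ] ⊆ ws → (y₁ ∷ y₂ ∷ []) ⊆ zs → y₂ < x → x < y₁ → ⊥

ComparesAlike : ℕ → ℕ → ℕ → ℕ → Set
ComparesAlike x y a b = ((x < a) ⇔ (y < b)) × ((a < x) ⇔ (b < y))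

module _ {x y a b : ℕ} where

  both-below : a < x → b < y → ComparesAlike x y a b
  both-below a<x b<y =
    mk⇔ (λ x<a → contradiction x<a (<-asym a<x)) (λ y<b → contradiction y<b (<-asym b<y)) ,
    mk⇔ (λ _ → b<y) (λ _ → a<x)

  both-above : x < a → y < b → ComparesAlike x y a b
  both-above x<a y<b =
    mk⇔ (λ _ → y<b) (λ _ → x<a) ,
    mk⇔ (λ a<x → contradiction a<x (<-asym x<a)) (λ b<y → contradiction b<y (<-asym y<b))

  below-from : ComparesAlike x y a b → b < y → a < x
  below-from r = Equivalence.from (proj₂ r)

  above-from : ComparesAlike x y a b → y < b → x < a
  above-from r = Equivalence.from (proj₁ r)

ordIso-312 : ∀ {a b c} → b < c → c < a → OrdIso (a ∷ b ∷ c ∷ []) (3 ∷ 1 ∷ 2 ∷ [])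
ordIso-312 b<c c<a =
  (both-below (<-trans b<c c<a) (s<s z<s) ∷ both-below c<a (s<s (s<s z<s)) ∷ []) ∷
  (both-above b<c (s<s z<s) ∷ []) ∷ [] ∷ []

ordIso-312⁻ : ∀ {xs} → OrdIso xs (3 ∷ 1 ∷ 2 ∷ []) →
  ∃ λ a → ∃₂ λ b c → xs ≡ a ∷ b ∷ c ∷ [] × b < c × c < a
ordIso-312⁻ ((_ ∷ r₂ ∷ []) ∷ (r₃ ∷ []) ∷ [] ∷ []) =
  _ , _ , _ , refl , above-from r₃ (s<s z<s) , below-from r₂ (s<s (s<s z<s))

ordIso-2431 : ∀ {a b c d} → d < a → a < c → c < b → OrdIso (a ∷ b ∷ c ∷ d ∷ []) (2 ∷ 4 ∷ 3 ∷ 1 ∷ [])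
ordIso-2431 d<a a<c c<b =
  (both-above (<-trans a<c c<b) (s<s (s<s z<s)) ∷ both-above a<c (s<s (s<s z<s)) ∷ both-below d<a (s<s z<s) ∷ []) ∷
  (both-below c<b (s<s (s<s (s<s z<s))) ∷ both-below (<-trans d<a (<-trans a<c c<b)) (s<s z<s) ∷ []) ∷
  (both-below (<-trans d<a a<c) (s<s z<s) ∷ []) ∷ [] ∷ []

ordIso-2431⁻ : ∀ {xs} → OrdIso xs (2 ∷ 4 ∷ 3 ∷ 1 ∷ []) →
  ∃₂ λ a b → ∃₂ λ c d → xs ≡ a ∷ b ∷ c ∷ d ∷ [] × d < a × a < c × c < b
ordIso-2431⁻ ((_ ∷ r₂ ∷ r₃ ∷ []) ∷ (r₄ ∷ _ ∷ []) ∷ _ ∷ [] ∷ []) =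
  _ , _ , _ , _ , refl , below-from r₃ (s<s z<s) , above-from r₂ (s<s (s<s z<s)) ,
  below-from r₄ (s<s (s<s (s<s z<s)))

ordIso-Descending : ∀ {xs ys} → OrdIso xs ys → Descending ys → Descending xs
ordIso-Descending [] [] = []
ordIso-Descending (rs ∷ iso) (y>ys ∷ desc) = below rs y>ys ∷ ordIso-Descending iso desc
  where
  below : ∀ {x y as bs} → Pointwise (ComparesAlike x y) as bs → All (_< y) bs → All (_< x) as
  below [] [] = []
  below (r ∷ rs) (b<y ∷ bs<y) = below-from r b<y ∷ below rs bs<y

Descending-ordIso : ∀ {xs ys} → Descending xs → Descending ys → length xs ≡ length ys → OrdIso xs ys
Descending-ordIso [] [] _ = []
Descending-ordIso (x>xs ∷ dx) (y>ys ∷ dy) eq =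
  below x>xs y>ys (suc-injective eq) ∷ Descending-ordIso dx dy (suc-injective eq)
  where
  below : ∀ {x y as bs} → All (_< x) as → All (_< y) bs → length as ≡ length bs →
    Pointwise (ComparesAlike x y) as bs
  below [] [] _ = []
  below (a<x ∷ as) (b<y ∷ bs) eq = both-below a<x b<y ∷ below as bs (suc-injective eq)

length-ordIso : ∀ {xs ys} → OrdIso xs ys → length xs ≡ length ys
length-ordIso [] = refl
length-ordIso (_ ∷ iso) = cong suc (length-ordIso iso)

decr-Descending : ∀ p → Descending (decr p)
decr-Descending p = descending (suc p)
  where
  below : ∀ m → All (_< suc m) (map suc (downFrom m))
  below zero = []
  below (suc m) = s<s (n<1+n m) ∷ All.map m<n⇒m<1+n (below m)
  descending : ∀ m → Descending (map suc (downFrom m))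
  descending zero = []
  descending (suc m) = below m ∷ descending m

length-decr : ∀ p → length (decr p) ≡ suc p
length-decr p = trans (length-map suc (downFrom (suc p))) (length-downFrom (suc p))

NoneBetween-resp-⊆ : ∀ {ws zs ws′ zs′} → ws′ ⊆ ws → zs′ ⊆ zs → NoneBetween ws zs → NoneBetween ws′ zs′
NoneBetween-resp-⊆ sw sz nb x∈ ys⊆ = nb (⊆-trans x∈ sw) (⊆-trans ys⊆ sz)

no-ascent⇒Descending : ∀ {zs} → Unique zs → (∀ {a b} → (a ∷ b ∷ []) ⊆ zs → ¬ a < b) → Descending zs
no-ascent⇒Descending [] _ = []
no-ascent⇒Descending {z ∷ zs} (z∉zs ∷ u) no-ascent =
  below z∉zs (λ b∈ → no-ascent (refl ∷ b∈)) ∷ no-ascent⇒Descending u (λ s → no-ascent (z ∷ʳ s))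
  where
  below : ∀ {bs} → All (λ b → ¬ z ≡ b) bs → (∀ {b} → [ b ] ⊆ bs → ¬ z < b) → All (_< z) bs
  below [] _ = []
  below (z≢b ∷ z≢bs) z≮ =
    ≤∧≢⇒< (≮⇒≥ (z≮ (refl ∷ []⊆-universal _))) (λ b≡z → z≢b (sym b≡z)) ∷ below z≢bs (λ s → z≮ (_ ∷ʳ s))

no-312-through-max : ∀ ws {N zs a b c} → ws ++ N ∷ zs ≡ a ∷ b ∷ c ∷ [] →
  All (_< N) ws → Descending zs → b < c → c < a → ⊥
no-312-through-max [] refl _ ((c<b ∷ []) ∷ _) b<c _ = <-asym b<c c<b
no-312-through-max (_ ∷ []) refl (a<N ∷ []) _ b<c c<a = <-asym (<-trans b<c c<a) a<N
no-312-through-max (_ ∷ _ ∷ []) refl (a<N ∷ _) _ _ c<a = <-asym c<a a<N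
no-312-through-max (_ ∷ _ ∷ _ ∷ []) ()
no-312-through-max (_ ∷ _ ∷ _ ∷ _ ∷ _) ()

no-2431-through-max : ∀ ws {N zs a b c d} → ws ++ N ∷ zs ≡ a ∷ b ∷ c ∷ d ∷ [] →
  All (_< N) ws → All (_< N) zs → NoneBetween ws zs → d < a → a < c → c < b → ⊥
no-2431-through-max [] refl _ (_ ∷ c<N ∷ _) _ _ a<c _ = <-asym a<c c<N
no-2431-through-max (_ ∷ []) refl _ _ nb d<a a<c _ = nb (refl ∷ []) (refl ∷ refl ∷ []) d<a a<c
no-2431-through-max (_ ∷ _ ∷ []) refl (_ ∷ b<N ∷ []) _ _ _ _ c<b = <-asym c<b b<N
no-2431-through-max (_ ∷ _ ∷ _ ∷ []) refl (a<N ∷ _) _ _ d<a _ _ = <-asym d<a a<N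
no-2431-through-max (_ ∷ _ ∷ _ ∷ _ ∷ []) ()
no-2431-through-max (_ ∷ _ ∷ _ ∷ _ ∷ _ ∷ _) ()

-- Permutations and their maximum

take-length-++ : ∀ (ws : List A) zs → take (length ws) (ws ++ zs) ≡ ws
take-length-++ [] zs = refl
take-length-++ (w ∷ ws) zs = cong (w ∷_) (take-length-++ ws zs)

drop-length-++ : ∀ (ws : List A) zs → drop (length ws) (ws ++ zs) ≡ zs
drop-length-++ [] zs = refl
drop-length-++ (w ∷ ws) zs = drop-length-++ ws zs

ins-++ : ∀ ws zs → ins (ws ++ zs) (suc (length zs)) ≡ ws ++ suc (length (ws ++ zs)) ∷ zs
ins-++ ws zs = cong₂ (λ as bs → as ++ suc (length (ws ++ zs)) ∷ bs)
  (trans (cong (λ t → take t (ws ++ zs)) prefix-length) (take-length-++ ws zs))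
  (trans (cong (λ t → drop t (ws ++ zs)) prefix-length) (drop-length-++ ws zs))
  where
  prefix-length : length (ws ++ zs) ∸ length zs ≡ length ws
  prefix-length = trans (cong (_∸ length zs) (length-++ ws)) (m+n∸n≡m (length ws) (length zs))

split-at-site : ∀ (γ : List A) m → m ≤ length γ → ∃₂ λ ws zs → ws ++ zs ≡ γ × length zs ≡ m
split-at-site γ m m≤ = take (length γ ∸ m) γ , drop (length γ ∸ m) γ , take++drop≡id (length γ ∸ m) γ ,
  trans (length-drop (length γ ∸ m) γ) (m∸[m∸n]≡n m≤)

IsPerm-insert-max : ∀ ws zs → IsPerm (ws ++ zs) → IsPerm (ws ++ suc (length (ws ++ zs)) ∷ zs)
IsPerm-insert-max ws zs γ↭ =
  subst (λ l → ws ++ N ∷ zs ↭ map suc (upTo l)) (sym (length-++-sucʳ ws N zs)) (begin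
    ws ++ N ∷ zs                ↭⟨ shift N ws zs ⟩
    N ∷ ws ++ zs                ↭⟨ prep N γ↭ ⟩
    N ∷ map suc (upTo n)        ↭⟨ ++-comm [ N ] (map suc (upTo n)) ⟩
    map suc (upTo n) ++ [ N ]   ≡⟨ sym (map-++ suc (upTo n) [ n ]) ⟩
    map suc (upTo n ++ [ n ])   ≡⟨ cong (map suc) (upTo-∷ʳ n) ⟩
    map suc (upTo (suc n))      ∎)
  where
  open PermutationReasoning
  n N : ℕ
  n = length (ws ++ zs)
  N = suc n

IsPerm⇒bounded : ∀ {γ} → IsPerm γ → All (_< suc (length γ)) γ
IsPerm⇒bounded {γ} γ↭ = All-resp-↭ (↭-sym γ↭) (All-map⁺ (All.map s<s (all-upTo (length γ))))

IsPerm⇒Unique : ∀ {γ} → IsPerm γ → Unique γ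
IsPerm⇒Unique {γ} γ↭ = Unique-resp-↭ (↭⇒↭ₛ (↭-sym γ↭)) (Unique-map⁺ suc-injective (upTo⁺ (length γ)))

IsPerm⇒length∈ : ∀ {γ} → IsPerm γ → 1 ≤ length γ → length γ ∈ γ
IsPerm⇒length∈ {γ} γ↭ 1≤ = ∈-resp-↭ (↭-sym γ↭) (top∈ (length γ) 1≤)
  where
  top∈ : ∀ n → 1 ≤ n → n ∈ map suc (upTo n)
  top∈ (suc m) _ = ∈-map⁺ suc (∈-upTo⁺ (n<1+n m))

splitAtValue : ℕ → List ℕ → List ℕ × List ℕ
splitAtValue v [] = [] , []
splitAtValue v (x ∷ xs) with x ≟ v
... | yes _ = [] , xs
... | no _ = x ∷ proj₁ (splitAtValue v xs) , proj₂ (splitAtValue v xs)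

splitAtValue-++-∷ : ∀ {v} ws {zs} → All (_≢ v) ws → splitAtValue v (ws ++ v ∷ zs) ≡ (ws , zs)
splitAtValue-++-∷ {v} [] _ with v ≟ v
... | yes _ = refl
... | no v≢v = contradiction refl v≢v
splitAtValue-++-∷ {v} (w ∷ ws) {zs} (w≢v ∷ ws≢v) with w ≟ v
... | yes w≡v = contradiction w≡v w≢v
... | no _ rewrite splitAtValue-++-∷ ws {zs} ws≢v = refl

splitAtValue-∈ : ∀ {v} xs → v ∈ xs →
  xs ≡ proj₁ (splitAtValue v xs) ++ v ∷ proj₂ (splitAtValue v xs) × All (_≢ v) (proj₁ (splitAtValue v xs))
splitAtValue-∈ {v} (x ∷ xs) v∈ with x ≟ v | v∈
... | yes refl | _ = refl , []
... | no x≢v | here v≡x = contradiction (sym v≡x) x≢v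
... | no x≢v | there v∈xs = Product.map (cong (x ∷_)) (x≢v ∷_) (splitAtValue-∈ xs v∈xs)

below-max : ∀ {n xs} → All (_< suc n) xs → All (_≢ n) xs → All (_< n) xs
below-max [] [] = []
below-max (x<1+n ∷ xs<1+n) (x≢n ∷ xs≢n) = ≤∧≢⇒< (≤-pred x<1+n) x≢n ∷ below-max xs<1+n xs≢n

IsPerm⇒max-split : ∀ {γ} → IsPerm γ → 1 ≤ length γ →
  ∃₂ λ as bs → γ ≡ as ++ length γ ∷ bs × All (_< length γ) as × All (_< length γ) bs
IsPerm⇒max-split {γ} γ↭ 1≤ with splitAtValue (length γ) γ | splitAtValue-∈ γ (IsPerm⇒length∈ γ↭ 1≤)
... | as , bs | γ≡ , as≢n =
  as , bs , γ≡ , below-max (All-resp-⊆ (++⁺ʳ _ ⊆-refl) γ<) as≢n ,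
  below-max (All-resp-⊆ (++⁺ˡ as (_ ∷ʳ ⊆-refl)) γ<) bs≢n
  where
  γ< : All (_< suc (length γ)) (as ++ length γ ∷ bs)
  γ< = subst (All (_< suc (length γ))) γ≡ (IsPerm⇒bounded γ↭)
  bs≢n : All (_≢ length γ) bs
  bs≢n with AllPairs-resp-⊆ (++⁺ˡ as ⊆-refl) (subst Unique γ≡ (IsPerm⇒Unique γ↭))
  ... | n∉bs ∷ _ = All.map (λ n≢b b≡n → n≢b (sym b≡n)) n∉bs

initialSegment : ∀ n → ℕ → Subset n
initialSegment zero _ = []
initialSegment (suc n) zero = outside ∷ initialSegment n zero
initialSegment (suc n) (suc k) = inside ∷ initialSegment n k

∣initialSegment∣ : ∀ n {k} → k ≤ n → ∣ initialSegment n k ∣ ≡ k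
∣initialSegment∣ zero z≤n = refl
∣initialSegment∣ (suc n) z≤n = ∣initialSegment∣ n z≤n
∣initialSegment∣ (suc n) (s≤s k≤n) = cong suc (∣initialSegment∣ n k≤n)

∈-initialSegment : ∀ n k (j : Fin n) → j ∈ₛ initialSegment n k ⇔ toℕ j < k
∈-initialSegment (suc n) zero fzero = mk⇔ (λ ()) (λ ())
∈-initialSegment (suc n) zero (fsuc j) =
  mk⇔ (λ j∈ → contradiction (Equivalence.to (∈-initialSegment n zero j) (drop-there j∈)) n≮0) (λ ())
∈-initialSegment (suc n) (suc k) fzero = mk⇔ (λ _ → z<s) (λ _ → here)
∈-initialSegment (suc n) (suc k) (fsuc j) =
  mk⇔ (λ j∈ → s<s (Equivalence.to (∈-initialSegment n k j) (drop-there j∈)))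
      (λ j<k → there (Equivalence.from (∈-initialSegment n k j) (s<s⁻¹ j<k)))

downClosed⇒initialSegment : ∀ {n} (s : Subset n) (Q : ℕ → Set) → (∀ j → j ∈ₛ s ⇔ Q (toℕ j)) →
  (∀ m → Q (suc m) → Q m) → ∀ j → j ∈ₛ s ⇔ toℕ j < ∣ s ∣
downClosed⇒initialSegment (inside ∷ s) Q s⇔Q down fzero = mk⇔ (λ _ → z<s) (λ _ → here)
downClosed⇒initialSegment (inside ∷ s) Q s⇔Q down (fsuc j) =
  mk⇔ (λ j∈ → s<s (Equivalence.to ih (drop-there j∈))) (λ j< → there (Equivalence.from ih (s<s⁻¹ j<)))
  where
  ih : j ∈ₛ s ⇔ toℕ j < ∣ s ∣
  ih = downClosed⇒initialSegment s (λ m → Q (suc m))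
         (λ j → s⇔Q (fsuc j) ⇔-∘ mk⇔ there drop-there) (λ m → down (suc m)) j
downClosed⇒initialSegment {suc n} (outside ∷ s) Q s⇔Q down j =
  mk⇔ (λ j∈ → contradiction j∈ (∉s′ j)) (λ j<∣s∣ → contradiction (subst (toℕ j <_) ∣s∣≡0 j<∣s∣) n≮0)
  where
  Q⇒Q0 : ∀ m → Q m → Q 0
  Q⇒Q0 zero q = q
  Q⇒Q0 (suc m) q = Q⇒Q0 m (down m q)
  ∉s′ : ∀ j → ¬ j ∈ₛ (outside ∷ s)
  ∉s′ j j∈ with Equivalence.from (s⇔Q fzero) (Q⇒Q0 _ (Equivalence.to (s⇔Q j) j∈))
  ... | ()
  ∣s∣≡0 : ∣ s ∣ ≡ 0
  ∣s∣≡0 = trans (cong ∣_∣ (Empty-unique λ (j , j∈) → ∉s′ (fsuc j) (there j∈))) (∣⊥∣≡0 n)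

indicator : {C : Set} → Dec C → Fin 2
indicator (yes _) = fzero
indicator (no _) = fsuc fzero

indicator-yes : {C : Set} (c? : Dec C) → C → indicator c? ≡ fzero
indicator-yes (yes _) _ = refl
indicator-yes (no ¬c) c = contradiction c ¬c

indicator-no : {C : Set} (c? : Dec C) → ¬ C → indicator c? ≡ fsuc fzero
indicator-no (yes c) ¬c = contradiction c ¬c
indicator-no (no _) _ = refl

indicator≡fzero⇒ : {C : Set} (c? : Dec C) → indicator c? ≡ fzero → C
indicator≡fzero⇒ (yes c) _ = c

indicator-cong : {C D : Set} → C ⇔ D → (c? : Dec C) (d? : Dec D) → indicator c? ≡ indicator d?
indicator-cong C⇔D c? (yes d) = indicator-yes c? (Equivalence.from C⇔D d)
indicator-cong C⇔D c? (no ¬d) = indicator-no c? (λ c → ¬d (Equivalence.to C⇔D c))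

μ-inner : ∀ p {i k} c → 2 ≤ i → i ≢ k → μ p i k c ≡ i
μ-inner p {suc (suc i)} {k} c (s≤s (s≤s _)) i≢k with suc (suc i) ≡ᵇ k | ≡ᵇ⇒≡ (suc (suc i)) k
... | true | i≡k = contradiction (i≡k _) i≢k
... | false | _ = refl

ν-inner : ∀ {i k} c → 2 ≤ i → i ≢ k → ν i k c ≡ fsuc fzero
ν-inner {suc (suc i)} {k} c (s≤s (s≤s _)) i≢k with suc (suc i) ≡ᵇ k | ≡ᵇ⇒≡ (suc (suc i)) k
... | true | i≡k = contradiction (i≡k _) i≢k
... | false | _ = refl

μ-last-up : ∀ {p i} → 2 ≤ i → i < p → μ p i i fzero ≡ suc i
μ-last-up {p} {suc (suc i)} (s≤s (s≤s _)) i<p with suc (suc i) ≡ᵇ suc (suc i) | ≡⇒≡ᵇ (suc (suc i)) _ refl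
... | true | _ with suc (suc i) <ᵇ p | <⇒<ᵇ i<p
...   | true | _ = refl

μ-last-stay : ∀ {p i} c → 2 ≤ i → ¬ (c ≡ fzero × i < p) → μ p i i c ≡ i
μ-last-stay {p} {suc (suc i)} c (s≤s (s≤s _)) ¬up with suc (suc i) ≡ᵇ suc (suc i) | ≡⇒≡ᵇ (suc (suc i)) _ refl
μ-last-stay {p} {suc (suc i)} (fsuc fzero) (s≤s (s≤s _)) ¬up | true | _ = refl
μ-last-stay {p} {suc (suc i)} fzero (s≤s (s≤s _)) ¬up | true | _ with suc (suc i) <ᵇ p | <ᵇ⇒< (suc (suc i)) p
... | true | i<p = contradiction (refl , i<p _) ¬up
... | false | _ = refl

ν-last : ∀ {i} c → 2 ≤ i → ν i i c ≡ c
ν-last {suc (suc i)} c (s≤s (s≤s _)) with suc (suc i) ≡ᵇ suc (suc i) | ≡⇒≡ᵇ (suc (suc i)) _ refl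
ν-last fzero (s≤s (s≤s _)) | true | _ = refl
ν-last (fsuc fzero) (s≤s (s≤s _)) | true | _ = refl

-- Active sites

module _ (p : ℕ) where

  P : List (List ℕ)
  P = Pset p

  Admissible : List ℕ → List ℕ → Set
  Admissible ws zs = Descending zs × length zs < p × NoneBetween ws zs

  insert-max-avoids : ∀ ws zs {N} → All (_< N) ws → All (_< N) zs →
    Avoids P (ws ++ zs) → Admissible ws zs → Avoids P (ws ++ N ∷ zs)
  insert-max-avoids ws zs ws<N zs<N (¬312 ∷ ¬2431 ∷ ¬decr ∷ []) (desc , short , nb) =
    ¬312′ ∷ ¬2431′ ∷ ¬decr′ ∷ []
    where
    ¬312′ : ¬ Contains (ws ++ _ ∷ zs) (3 ∷ 1 ∷ 2 ∷ [])
    ¬312′ (β , s , iso) with ⊆-++-∷⁻ ws s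
    ... | inj₁ t = ¬312 (β , t , iso)
    ... | inj₂ (ws′ , zs′ , refl , sw , sz) with ordIso-312⁻ iso
    ...   | _ , _ , _ , eq , b<c , c<a =
      no-312-through-max ws′ eq (All-resp-⊆ sw ws<N) (AllPairs-resp-⊆ sz desc) b<c c<a
    ¬2431′ : ¬ Contains (ws ++ _ ∷ zs) (2 ∷ 4 ∷ 3 ∷ 1 ∷ [])
    ¬2431′ (β , s , iso) with ⊆-++-∷⁻ ws s
    ... | inj₁ t = ¬2431 (β , t , iso)
    ... | inj₂ (ws′ , zs′ , refl , sw , sz) with ordIso-2431⁻ iso
    ...   | _ , _ , _ , _ , eq , d<a , a<c , c<b =
      no-2431-through-max ws′ eq (All-resp-⊆ sw ws<N) (All-resp-⊆ sz zs<N)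
        (NoneBetween-resp-⊆ sw sz nb) d<a a<c c<b
    ¬decr′ : ¬ Contains (ws ++ _ ∷ zs) (decr p)
    ¬decr′ (β , s , iso) with ⊆-++-∷⁻ ws s
    ... | inj₁ t = ¬decr (β , t , iso)
    -- an occurrence through N must begin at N, leaving p of its entries inside zs
    ... | inj₂ ([] , zs′ , refl , _ , sz) =
      <-irrefl refl (≤-<-trans (subst (_≤ length zs) (suc-injective (trans (length-ordIso iso) (length-decr p)))
                                       (length-mono-≤ sz)) short)
    ... | inj₂ (w ∷ ws′ , zs′ , refl , sw , _) with ordIso-Descending iso (decr-Descending p)
    ...   | w>rest ∷ _ = <-asym (lookup-⊆ w>rest (++⁺ˡ ws′ (refl ∷ []⊆-universal zs′))) (lookup-⊆ ws<N (head-⊆ sw))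

  avoids-insert-max⇒Admissible : ∀ ws zs {N} → All (_< N) zs → Unique zs →
    Avoids P (ws ++ N ∷ zs) → Admissible ws zs
  avoids-insert-max⇒Admissible ws zs zs<N u (¬312 ∷ ¬2431 ∷ ¬decr ∷ []) = desc , short , nb
    where
    desc : Descending zs
    desc = no-ascent⇒Descending u λ s a<b →
      ¬312 (_ , ++⁺ˡ ws (refl ∷ s) , ordIso-312 a<b (lookup-⊆ zs<N (∷ˡ⁻ s)))
    short : length zs < p
    short with p ≤? length zs
    ... | no p≰ = ≰⇒> p≰
    -- otherwise N followed by the first p entries of zs is an occurrence of decr p
    ... | yes p≤ = contradiction (_ , ++⁺ˡ ws (refl ∷ take-⊆ p zs) , Descending-ordIso
          (All-resp-⊆ (take-⊆ p zs) zs<N ∷ AllPairs-resp-⊆ (take-⊆ p zs) desc) (decr-Descending p)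
          (cong suc (trans (length-take p zs) (trans (m≤n⇒m⊓n≡m p≤) (sym (suc-injective (length-decr p))))))) ¬decr
    nb : NoneBetween ws zs
    nb x∈ ys⊆ y₂<x x<y₁ =
      ¬2431 (_ , ++⁺ x∈ (refl ∷ ys⊆) , ordIso-2431 y₂<x x<y₁ (lookup-⊆ zs<N (head-⊆ ys⊆)))

  Admissible-shift : ∀ ws ys {zs} → Admissible ws (ys ++ zs) → Admissible (ws ++ ys) zs
  Admissible-shift ws ys {zs} (desc , short , nb) =
    AllPairs-resp-⊆ (++⁺ˡ ys ⊆-refl) desc , ≤-<-trans (length-++-≤ʳ zs {ys}) short , nb′
    where
    nb′ : NoneBetween (ws ++ ys) zs
    nb′ x∈ pair y₂<x x<y₁ with [x]⊆-++⁻ ws x∈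
    ... | inj₁ x∈ws = nb x∈ws (++⁺ˡ ys pair) y₂<x x<y₁
    ... | inj₂ x∈ys = <-asym x<y₁ (AllPairs-pair desc (++⁺ x∈ys (head-⊆ pair)))

  Admissible-snoc-max : ∀ ws {M zs} → All (_< M) zs → Admissible ws zs → Admissible (ws ++ [ M ]) zs
  Admissible-snoc-max ws zs<M (desc , short , nb) = desc , short , nb′
    where
    nb′ : NoneBetween (ws ++ [ _ ]) _
    nb′ x∈ pair y₂<x x<y₁ with [x]⊆-++⁻ ws x∈
    ... | inj₁ x∈ws = nb x∈ws pair y₂<x x<y₁
    ... | inj₂ (refl ∷ _) = <-asym x<y₁ (lookup-⊆ zs<M (head-⊆ pair))

  active⇔Admissible : ∀ {γ} ws zs → ws ++ zs ≡ γ → InS P γ →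
    Active P γ (suc (length zs)) ⇔ Admissible ws zs
  active⇔Admissible ws zs refl (γ↭ , γ-avoids) = mk⇔ to from
    where
    N : ℕ
    N = suc (length (ws ++ zs))
    ws<N : All (_< N) ws
    ws<N = All-resp-⊆ (++⁺ʳ zs ⊆-refl) (IsPerm⇒bounded γ↭)
    zs<N : All (_< N) zs
    zs<N = All-resp-⊆ (++⁺ˡ ws ⊆-refl) (IsPerm⇒bounded γ↭)
    to : Active P (ws ++ zs) (suc (length zs)) → Admissible ws zs
    to (_ , _ , _ , β-avoids) = avoids-insert-max⇒Admissible ws zs zs<N
      (AllPairs-resp-⊆ (++⁺ˡ ws ⊆-refl) (IsPerm⇒Unique γ↭)) (subst (Avoids P) (ins-++ ws zs) β-avoids)
    from : Admissible ws zs → Active P (ws ++ zs) (suc (length zs))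
    from adm = s≤s z≤n , s≤s (length-++-≤ʳ zs {ws}) , subst (InS P) (sym (ins-++ ws zs))
      (IsPerm-insert-max ws zs γ↭ , insert-max-avoids ws zs ws<N zs<N γ-avoids adm)

  active-step-down : ∀ {γ} → InS P γ → ∀ m → Active P γ (suc (suc m)) → Active P γ (suc m)
  active-step-down {γ} γ∈S m act with split-at-site γ (suc m) (s≤s⁻¹ (proj₁ (proj₂ act)))
  ... | ws , z ∷ zs , refl , refl =
    Equivalence.from (active⇔Admissible (ws ++ [ z ]) zs (++-assoc ws [ z ] zs) γ∈S)
      (Admissible-shift ws [ z ] (Equivalence.to (active⇔Admissible ws (z ∷ zs) refl γ∈S) act))

  ActiveExactly : List ℕ → ℕ → Set
  ActiveExactly γ k = k ≤ suc (length γ) × (∀ m → m ≤ length γ → Active P γ (suc m) ⇔ m < k)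

  NumActive⇒ActiveExactly : ∀ {γ k} → InS P γ → NumActive P γ k → ActiveExactly γ k
  NumActive⇒ActiveExactly {γ} γ∈S (s , refl , s⇔act) = ∣p∣≤n s , λ m m≤ →
    subst (λ m → Active P γ (suc m) ⇔ m < ∣ s ∣) (toℕ-fromℕ< (s≤s m≤)) (initial (fromℕ< (s≤s m≤)))
    where
    initial : ∀ j → Active P γ (suc (toℕ j)) ⇔ toℕ j < ∣ s ∣
    initial j = downClosed⇒initialSegment s (λ m → Active P γ (suc m)) s⇔act (active-step-down γ∈S) j
      ⇔-∘ ⇔-sym (s⇔act j)

  ActiveExactly⇒NumActive : ∀ {γ k} → ActiveExactly γ k → NumActive P γ k
  ActiveExactly⇒NumActive {γ} {k} (k≤ , act⇔) = initialSegment _ k , ∣initialSegment∣ _ k≤ ,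
    λ j → ⇔-sym (act⇔ (toℕ j) (s≤s⁻¹ (toℕ<n j))) ⇔-∘ ∈-initialSegment _ k j

  ActiveExactly-unique : ∀ {γ k k′} → ActiveExactly γ k → ActiveExactly γ k′ → k ≡ k′
  ActiveExactly-unique k-exact k′-exact =
    ≤-antisym (≮⇒≥ (not-below k′-exact k-exact)) (≮⇒≥ (not-below k-exact k′-exact))
    where
    not-below : ∀ {γ k k′} → ActiveExactly γ k → ActiveExactly γ k′ → ¬ k < k′
    not-below {γ} {k} (_ , act⇔) (k′≤ , act⇔′) k<k′ =
      <-irrefl refl (Equivalence.to (act⇔ k k≤n) (Equivalence.from (act⇔′ k k≤n) k<k′))
      where
      k≤n : k ≤ length γ
      k≤n = s≤s⁻¹ (≤-trans k<k′ k′≤)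

  -- The max site of A ++ M ∷ S is site |S|+2, immediately to the left of M.
  module _ {A M S} (γ∈S : InS P (A ++ M ∷ S)) (A<M : All (_< M) A) (S<M : All (_< M) S) where

    max-suffix-Admissible : Admissible A S
    max-suffix-Admissible = avoids-insert-max⇒Admissible A S S<M
        (AllPairs-resp-⊆ (++⁺ˡ A (M ∷ʳ ⊆-refl)) (IsPerm⇒Unique (proj₁ γ∈S))) (proj₂ γ∈S)

    active-within-max-suffix : ∀ m → m ≤ length S → Active P (A ++ M ∷ S) (suc m)
    active-within-max-suffix m m≤ with split-at-site S m m≤
    ... | S₁ , S₂ , refl , refl =
      Equivalence.from (active⇔Admissible (A ++ M ∷ S₁) S₂ (++-assoc A (M ∷ S₁) S₂) γ∈S)
        (subst (λ ws → Admissible ws S₂) (++-assoc A [ M ] S₁)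
          (Admissible-shift (A ++ [ M ]) S₁ (Admissible-snoc-max A S<M max-suffix-Admissible)))

    inactive-beyond-max : ∀ m → suc (suc (length S)) ≤ m → ¬ Active P (A ++ M ∷ S) (suc m)
    inactive-beyond-max m 2+S≤m act with split-at-site (A ++ M ∷ S) m (s≤s⁻¹ (proj₁ (proj₂ act)))
    ... | ws , zs , eq , refl with long-suffix-crosses ws zs A S eq 2+S≤m
    ...   | a , a∈A , a-before-M =
      <-asym (lookup-⊆ A<M a∈A)
        (AllPairs-pair (proj₁ (Equivalence.to (active⇔Admissible ws zs eq γ∈S) act)) a-before-M)

    Admissible-max⇔ : Admissible A (M ∷ S) ⇔ (suc (length S) < p × A ≪ S)
    Admissible-max⇔ = mk⇔ (λ (_ , short , nb) → short , A≪S nb)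
                          (λ (short , A≪S) → (S<M ∷ proj₁ max-suffix-Admissible) , short , nb A≪S)
      where
      A≢S : ∀ {a b} → [ a ] ⊆ A → [ b ] ⊆ S → a ≢ b
      A≢S a∈ b∈ = AllPairs-pair (IsPerm⇒Unique (proj₁ γ∈S)) (++⁺ a∈ (M ∷ʳ b∈))
      A≪S : NoneBetween A (M ∷ S) → A ≪ S
      A≪S nb = All.tabulate λ a∈ → All.tabulate λ b∈ →
        ≤∧≢⇒< (≮⇒≥ λ b<a → nb (from∈ a∈) (refl ∷ from∈ b∈) b<a (lookup-⊆ A<M (from∈ a∈)))
              (A≢S (from∈ a∈) (from∈ b∈))
      nb : A ≪ S → NoneBetween A (M ∷ S)
      nb A≪S a∈ pair y₂<a _ = <-asym y₂<a (lookup-⊆ (lookup-⊆ A≪S a∈) (∷⁻ pair))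

    ActiveExactly-max : ∀ {k} → suc (length S) ≤ k → k ≤ suc (suc (length S)) →
      (Active P (A ++ M ∷ S) (suc (suc (length S))) ⇔ suc (length S) < k) → ActiveExactly (A ++ M ∷ S) k
    ActiveExactly-max {k} 1+S≤k k≤2+S middle = ≤-trans k≤2+S (s≤s (length-++-≤ʳ (M ∷ S) {A})) , classify
      where
      classify : ∀ m → m ≤ length (A ++ M ∷ S) → Active P (A ++ M ∷ S) (suc m) ⇔ m < k
      classify m _ with <-cmp m (suc (length S))
      ... | tri< m<1+S _ _ = mk⇔ (λ _ → <-≤-trans m<1+S 1+S≤k) (λ _ → active-within-max-suffix m (s≤s⁻¹ m<1+S))
      ... | tri≈ _ refl _ = middle
      ... | tri> _ _ 1+S<m = mk⇔ (λ act → contradiction act (inactive-beyond-max m 1+S<m))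
                                  (λ m<k → contradiction (<-≤-trans m<k k≤2+S) (≤⇒≯ 1+S<m))

    ActiveExactly-max-site-active : suc (length S) < p → A ≪ S → ActiveExactly (A ++ M ∷ S) (suc (suc (length S)))
    ActiveExactly-max-site-active short A≪S = ActiveExactly-max (n≤1+n _) ≤-refl (mk⇔ (λ _ → ≤-refl)
      (λ _ → Equivalence.from (active⇔Admissible A (M ∷ S) refl γ∈S)
               (Equivalence.from Admissible-max⇔ (short , A≪S))))

    ActiveExactly-max-site-inactive : ¬ (suc (length S) < p × A ≪ S) → ActiveExactly (A ++ M ∷ S) (suc (length S))
    ActiveExactly-max-site-inactive ¬up = ActiveExactly-max ≤-refl (n≤1+n _) (mk⇔
      (λ act → contradiction
        (Equivalence.to Admissible-max⇔ (Equivalence.to (active⇔Admissible A (M ∷ S) refl γ∈S) act)) ¬up)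
      (λ 1+S<1+S → contradiction 1+S<1+S (<-irrefl refl)))

  colourOf : List ℕ → List ℕ → Fin 2
  colourOf as bs = indicator (as ≪? bs ⊎-dec suc (length bs) ≟ p)

  colour : List ℕ → Fin 2
  colour γ = uncurry colourOf (splitAtValue (length γ) γ)

  colour-max-split : ∀ as M bs → length (as ++ M ∷ bs) ≡ M → All (_< M) as →
    colour (as ++ M ∷ bs) ≡ colourOf as bs
  colour-max-split as M bs len≡M as<M = cong (uncurry colourOf)
    (trans (cong (λ v → splitAtValue v (as ++ M ∷ bs)) len≡M) (splitAtValue-++-∷ as (All.map <⇒≢ as<M)))

  colourOf-unsorted : ∀ {as bs} → ¬ as ≪ bs → colourOf as bs ≡ indicator (suc (length bs) ≟ p)
  colourOf-unsorted {as} {bs} ¬as≪bs = indicator-cong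
    (mk⇔ (λ { (inj₁ as≪bs) → contradiction as≪bs ¬as≪bs ; (inj₂ 1+bs≡p) → 1+bs≡p }) inj₂)
    (as ≪? bs ⊎-dec suc (length bs) ≟ p) (suc (length bs) ≟ p)

  -- Inserting the new maximum at site |Y|+1 of X ++ Y

  InsertionRule : List ℕ → List ℕ → ℕ → Fin 2 → Set
  InsertionRule X Y k c = NumActive P β (μ p (suc (length Y)) k c) × (colour β ≡ ν (suc (length Y)) k c)
    where
    β : List ℕ
    β = X ++ suc (length (X ++ Y)) ∷ Y

  module Insertion {X Y k} (α∈S : InS P (X ++ Y)) (k-exact : ActiveExactly (X ++ Y) k)
                   (i≤k : suc (length Y) ≤ k) where

    N : ℕ
    N = suc (length (X ++ Y))

    β∈S : InS P (X ++ N ∷ Y)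
    β∈S = subst (InS P) (ins-++ X Y)
      (proj₂ (proj₂ (Equivalence.from (proj₂ k-exact (length Y) (length-++-≤ʳ Y {X})) i≤k)))

    X<N : All (_< N) X
    X<N = All-resp-⊆ (++⁺ʳ Y ⊆-refl) (IsPerm⇒bounded (proj₁ α∈S))

    Y<N : All (_< N) Y
    Y<N = All-resp-⊆ (++⁺ˡ X ⊆-refl) (IsPerm⇒bounded (proj₁ α∈S))

    β-up : suc (length Y) < p → X ≪ Y → NumActive P (X ++ N ∷ Y) (suc (suc (length Y)))
    β-up short X≪Y = ActiveExactly⇒NumActive (ActiveExactly-max-site-active β∈S X<N Y<N short X≪Y)

    β-stay : ¬ (suc (length Y) < p × X ≪ Y) → NumActive P (X ++ N ∷ Y) (suc (length Y))
    β-stay ¬up = ActiveExactly⇒NumActive (ActiveExactly-max-site-inactive β∈S X<N Y<N ¬up)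

    colour-β : colour (X ++ N ∷ Y) ≡ colourOf X Y
    colour-β = colour-max-split X N Y (length-++-sucʳ X N Y) X<N

  module InsertionBeforeEnd {X Y k A S} (α∈S : InS P (X ++ Y)) (k-exact : ActiveExactly (X ++ Y) k)
      (i≤k : suc (length Y) ≤ k) (1≤Y : 1 ≤ length Y) (α≡ : X ++ Y ≡ A ++ length (X ++ Y) ∷ S)
      (A<n : All (_< length (X ++ Y)) A) (S<n : All (_< length (X ++ Y)) S) where

    open Insertion {X} {Y} α∈S k-exact i≤k

    private
      n : ℕ
      n = length (X ++ Y)
      2≤i : 2 ≤ suc (length Y)
      2≤i = s≤s 1≤Y

    α∈S′ : InS P (A ++ n ∷ S)
    α∈S′ = subst (InS P) α≡ α∈S

    k-exact′ : ActiveExactly (A ++ n ∷ S) k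
    k-exact′ = subst (λ γ → ActiveExactly γ k) α≡ k-exact

    colour-α : colour (X ++ Y) ≡ colourOf A S
    colour-α = trans (cong colour α≡) (colour-max-split A n S (cong length (sym α≡)) A<n)

    S-short : length S < p
    S-short = proj₁ (proj₂ (max-suffix-Admissible α∈S′ A<n S<n))

    ¬≪-within : length Y ≤ length S → ¬ X ≪ Y
    ¬≪-within Y≤S with ++-∷-short-suffix X Y A S α≡ Y≤S
    ... | n∈X , Y⊆S = ≪-after n∈X (All-resp-⊆ Y⊆S S<n) 1≤Y

    inner-site : ∀ {c} → suc (length Y) ≢ k → length Y ≤ length S → suc (length Y) ≢ p → InsertionRule X Y k c
    inner-site {c} i≢k Y≤S i≢p =
      subst (NumActive P _) (sym (μ-inner p c 2≤i i≢k)) (β-stay (¬≪-within Y≤S ∘ proj₂)) ,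
      (begin
        colour (X ++ N ∷ Y)                 ≡⟨ colour-β ⟩
        colourOf X Y                        ≡⟨ colourOf-unsorted (¬≪-within Y≤S) ⟩
        indicator (suc (length Y) ≟ p)      ≡⟨ indicator-no _ i≢p ⟩
        fsuc fzero                          ≡⟨ ν-inner c 2≤i i≢k ⟨
        ν (suc (length Y)) k c              ∎)
      where open ≡-Reasoning

    last-site-when-≪ : X ≪ Y → InsertionRule X Y (suc (length Y)) fzero
    last-site-when-≪ X≪Y = numActive (suc (length Y) <? p) ,
      trans colour-β (trans (indicator-yes _ (inj₁ X≪Y)) (sym (ν-last fzero 2≤i)))
      where
      numActive : Dec (suc (length Y) < p) → NumActive P (X ++ N ∷ Y) (μ p (suc (length Y)) (suc (length Y)) fzero)
      numActive (yes short) = subst (NumActive P _) (sym (μ-last-up 2≤i short)) (β-up short X≪Y)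
      numActive (no ¬short) =
        subst (NumActive P _) (sym (μ-last-stay fzero 2≤i (¬short ∘ proj₂))) (β-stay (¬short ∘ proj₁))

    max-site-active-case : suc (length S) < p → A ≪ S → InsertionRule X Y k (colour (X ++ Y))
    max-site-active-case short A≪S = by-length (length Y ≤? length S)
      where
      k≡ : k ≡ suc (suc (length S))
      k≡ = ActiveExactly-unique k-exact′ (ActiveExactly-max-site-active α∈S′ A<n S<n short A≪S)
      by-length : Dec (length Y ≤ length S) → InsertionRule X Y k (colour (X ++ Y))
      by-length (yes Y≤S) = inner-site (λ i≡k → <⇒≢ (s≤s (s≤s Y≤S)) (trans i≡k k≡)) Y≤S
                              (<⇒≢ (≤-<-trans (s≤s Y≤S) short))
      by-length (no Y≰S) with ++-∷-suffix-≡ X Y A S α≡ Y≡1+S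
        where
        Y≡1+S : length Y ≡ suc (length S)
        Y≡1+S = ≤-antisym (s≤s⁻¹ (≤-trans i≤k (≤-reflexive k≡))) (≰⇒> Y≰S)
      ... | X≡A , Y≡ = subst₂ (InsertionRule X Y) (trans (cong (suc ∘ length) Y≡) (sym k≡))
                         (sym (trans colour-α (indicator-yes _ (inj₁ A≪S))))
                         (last-site-when-≪ (subst₂ _≪_ (sym X≡A) (sym Y≡) (≪-∷ A<n A≪S)))

    max-site-inactive-case : ¬ (suc (length S) < p × A ≪ S) → InsertionRule X Y k (colour (X ++ Y))
    max-site-inactive-case ¬up = by-length (length Y ≟ length S)
      where
      k≡ : k ≡ suc (length S)
      k≡ = ActiveExactly-unique k-exact′ (ActiveExactly-max-site-inactive α∈S′ A<n S<n ¬up)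
      Y≤S : length Y ≤ length S
      Y≤S = s≤s⁻¹ (≤-trans i≤k (≤-reflexive k≡))
      colour-β′ : colour (X ++ N ∷ Y) ≡ indicator (suc (length Y) ≟ p)
      colour-β′ = trans colour-β (colourOf-unsorted (¬≪-within Y≤S))
      colour-α′ : colour (X ++ Y) ≡ indicator (suc (length S) ≟ p)
      colour-α′ = trans colour-α (indicator-cong (mk⇔ at-p inj₂) _ _)
        where
        at-p : A ≪ S ⊎ suc (length S) ≡ p → suc (length S) ≡ p
        at-p (inj₁ A≪S) = ≤-antisym S-short (≮⇒≥ (λ short → ¬up (short , A≪S)))
        at-p (inj₂ 1+S≡p) = 1+S≡p
      by-length : Dec (length Y ≡ length S) → InsertionRule X Y k (colour (X ++ Y))
      by-length (no Y≢S) = inner-site (λ i≡k → Y≢S (suc-injective (trans i≡k k≡))) Y≤S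
                             (<⇒≢ (<-≤-trans (s<s (≤∧≢⇒< Y≤S Y≢S)) S-short))
      by-length (yes Y≡S) = subst (λ k → InsertionRule X Y k (colour (X ++ Y))) (trans (cong suc Y≡S) (sym k≡))
        (subst (NumActive P _) (sym (μ-last-stay _ 2≤i not-up)) (β-stay (¬≪-within Y≤S ∘ proj₂)) ,
        (begin
          colour (X ++ N ∷ Y)                                   ≡⟨ colour-β′ ⟩
          indicator (suc (length Y) ≟ p)                        ≡⟨ cong (λ l → indicator (suc l ≟ p)) Y≡S ⟩
          indicator (suc (length S) ≟ p)                        ≡⟨ colour-α′ ⟨
          colour (X ++ Y)                                       ≡⟨ ν-last _ 2≤i ⟨
          ν (suc (length Y)) (suc (length Y)) (colour (X ++ Y)) ∎))
        where
        open ≡-Reasoning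
        not-up : ¬ (colour (X ++ Y) ≡ fzero × suc (length Y) < p)
        not-up (c≡0 , i<p) =
          <⇒≢ i<p (trans (cong suc Y≡S) (indicator≡fzero⇒ (suc (length S) ≟ p) (trans (sym colour-α′) c≡0)))

  insert-at-split : 2 ≤ p → ∀ X Y {k} (α∈S : InS P (X ++ Y)) (k-exact : ActiveExactly (X ++ Y) k)
    (i≤k : suc (length Y) ≤ k) → InsertionRule X Y k (colour (X ++ Y))
  insert-at-split p≥2 X [] α∈S k-exact i≤k = β-up p≥2 X≪[] , trans colour-β (indicator-yes _ (inj₁ X≪[]))
    where
    open Insertion {X} {[]} α∈S k-exact i≤k
    X≪[] : X ≪ []
    X≪[] = All.tabulate (λ _ → [])
  insert-at-split p≥2 X Y@(_ ∷ _) {k} α∈S k-exact i≤k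
    with IsPerm⇒max-split (proj₁ α∈S) (≤-trans (s≤s z≤n) (length-++-≤ʳ Y {X}))
  ... | A , S , α≡ , A<n , S<n = by-shape ((suc (length S) <? p) ×-dec (A ≪? S))
    where
    open InsertionBeforeEnd {X} {Y} α∈S k-exact i≤k (s≤s z≤n) α≡ A<n S<n
    by-shape : Dec (suc (length S) < p × A ≪ S) → InsertionRule X Y k (colour (X ++ Y))
    by-shape (yes (short , A≪S)) = max-site-active-case short A≪S
    by-shape (no ¬up) = max-site-inactive-case ¬up

  insertion-step : 2 ≤ p → ∀ {α k} → InS P α → NumActive P α k → ∀ i → 1 ≤ i → i ≤ k →
    NumActive P (ins α i) (μ p i k (colour α)) × (colour (ins α i) ≡ ν i k (colour α))
  insertion-step p≥2 {α} α∈S #k (suc m) _ i≤k with NumActive⇒ActiveExactly α∈S #k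
  ... | k-exact with split-at-site α m (s≤s⁻¹ (≤-trans i≤k (proj₁ k-exact)))
  ...   | X , Y , refl , refl rewrite ins-++ X Y = insert-at-split p≥2 X Y α∈S k-exact i≤k

  site1-active : 2 ≤ p → ∀ {α} → InS P α → Active P α 1
  site1-active p≥2 {α} α∈S = Equivalence.from (active⇔Admissible α [] (++-identityʳ α) α∈S)
    ([] , ≤-trans (s≤s z≤n) p≥2 , λ _ ())

theorem3 : ∀ (p : ℕ) → 2 ≤ p →
    Σ (List ℕ → Fin 2) λ col →
      (col [] ≡ fzero) ×
      (∀ (α : List ℕ) → InS (Pset p) α →
        Active (Pset p) α 1 ×
        (∀ (k : ℕ) → NumActive (Pset p) α k →
          ∀ (i : ℕ) → 1 ≤ i → i ≤ k →
            NumActive (Pset p) (ins α i) (μ p i k (col α)) ×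
            (col (ins α i) ≡ ν i k (col α))))
theorem3 p p≥2 = colour p , refl , λ α α∈S →
  site1-active p p≥2 α∈S , λ k #k i 1≤i i≤k → insertion-step p p≥2 α∈S #k i 1≤i i≤k
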